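{- Let $F$ be a tract and let $A$ be an $m\times n$ matrix with entries in $F$. Then $r_{\mathrm{col}}(A)\le r_{\mathrm{mat}}(A)$.
   Context: A tract is a multiplicatively written commutative monoid $F$ with an absorbing element $0$ such that $F^\times = F\setminus\{0\}$ is a group, together with a subset $N_F$ (the null set) of the group semiring $\mathbb{N}[F^\times]$ (finite formal sums of elements of $F^\times$), such that: the zero element of $\mathbb{N}[F^\times]$ lies in $N_F$; there is a unique $\epsilon\in F^\times$ with $1+\epsilon\in N_F$ (written $-1$); and $N_F$ is closed under multiplication by elements of $F^\times$. A formal sum $\sum_i x_i$ with $x_i\in F$ is regarded as an element of $\mathbb{N}[F^\times]$ by discarding zero terms. Vectors $X,Y\in F^n$ are orthogonal if $\sum_i X_iY_i\in N_F$. Vectors $X_1,\dots,X_k\in F^n$ are linearly dependent over $F$ if there are $c_1,\dots,c_k\in F$, not all zero, with $\sum_i c_iX_i\in (N_F)^n$ (coordinatewise), and linearly independent otherwise. An $F$-matroid $M$ of rank $r$ on $[n]$ is a matroid $\underline{M}$ of rank $r$ on $[n]$ together with subsets $\mathcal{C}(M),\mathcal{C}^*(M)\subseteq F^n$ ($F$-circuits and $F$-cocircuits) such that: (1) both sets are closed under multiplication by $F^\times$; (2) the support of every $F$-circuit is a circuit of $\underline{M}$ and the support of every $F$-cocircuit is a cocircuit of $\underline{M}$; (3) for every circuit (resp. cocircuit) of $\underline{M}$ there is an $F$-circuit (resp. $F$-cocircuit) with that support, unique up to multiplication by an element of $F^\times$; (4) every $F$-circuit is orthogonal to every $F$-cocircuit.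 A covector of $M$ is an $X\in F^n$ orthogonal to every $F$-circuit of $M$. The column rank $r_{\mathrm{col}}(A)$ is the maximum number of linearly independent columns of $A$; the matroidal rank $r_{\mathrm{mat}}(A)$ is the minimal rank of an $F$-matroid on $[n]$ such that every row of $A$ is a covector of it. -}

module Defs where

open import Level using (Level; 0ℓ; suc)
open import Data.Nat using (ℕ; _≤_)
open import Data.Fin using (Fin)
open import Data.Fin.Subset using (Subset; _∈_; _∉_; _⊆_; _⊂_; _∩_; _∪_; _-_; ⁅_⁆; ∣_∣; Nonempty)
open import Data.Bool using (Bool; true; false)
open import Data.Maybe using (Maybe; just; nothing; is-just)
open import Data.List using (List; []; _∷_; map; catMaybes)
import Data.List as List
open import Data.List.Relation.Binary.Permutation.Propositional using (_↭_)
open import Data.Vec using (Vec; lookup; tabulate)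
open import Data.Product using (Σ; ∃; ∃-syntax; _×_; _,_)
open import Relation.Binary.PropositionalEquality using (_≡_; _≢_)
open import Relation.Nullary using (¬_)

-- The unit group F^× is an abelian group U; the tract is F = Maybe U,
-- where `nothing` is the absorbing element 0 and `just u` is the unit u.
-- Elements of the group semiring ℕ[F^×] (finite formal sums of units)
-- are represented by lists of units; the null set is required to be
-- invariant under permutation, so it is really a set of multisets.

record Tract : Set₁ where
  field
    U      : Set
    _·_    : U → U → U
    one    : U
    inv    : U → U
    ·-assoc : ∀ x y z → (x · y) · z ≡ x · (y · z)
    ·-comm  : ∀ x y → x · y ≡ y · x
    ·-identityˡ : ∀ x → one · x ≡ x
    ·-inverseˡ  : ∀ x → inv x · x ≡ one
    N      : List U → Set
    N-perm : ∀ {xs ys} → xs ↭ ys → N xs → N ys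
    N-zero : N []
    N-neg  : ∃[ ε ] (N (one ∷ ε ∷ []) × (∀ δ → N (one ∷ δ ∷ []) → δ ≡ ε))
    N-mult : ∀ c xs → N xs → N (map (c ·_) xs)

  F : Set
  F = Maybe U

  0F : F
  0F = nothing

  infixl 7 _*_
  _*_ : F → F → F
  just x * just y = just (x · y)
  _ * _ = nothing

  formalSum : List F → List U
  formalSum = catMaybes

  NullSum : List F → Set
  NullSum xs = N (formalSum xs)

  scale : ∀ {n} → F → Vec F n → Vec F n
  scale c X = Data.Vec.map (c *_) X

  supp : ∀ {n} → Vec F n → Subset n
  supp X = Data.Vec.map is-just X

  Orthogonal : ∀ {n} → Vec F n → Vec F n → Set
  Orthogonal {n} X Y = NullSum (List.tabulate {n = n} (λ i → lookup X i * lookup Y i))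

  LinDep : ∀ {k m} → (Fin k → Vec F m) → Set
  LinDep {k} {m} X =
    Σ (Fin k → F) λ c →
      (∃[ j ] c j ≢ nothing) ×
      (∀ (i : Fin m) → NullSum (List.tabulate {n = k} (λ j → c j * lookup (X j) i)))

  LinIndep : ∀ {k m} → (Fin k → Vec F m) → Set
  LinIndep X = ¬ LinDep X


record Matroid (n : ℕ) : Set₁ where
  field
    IsBasis : Subset n → Set
    basis-exists : ∃[ B ] IsBasis B
    exchange : ∀ {B₁ B₂} → IsBasis B₁ → IsBasis B₂ →
               ∀ x → x ∈ B₁ → x ∉ B₂ →
               ∃[ y ] (y ∈ B₂ × y ∉ B₁ × IsBasis ((B₁ - x) ∪ ⁅ y ⁆))

  Independent : Subset n → Set
  Independent I = ∃[ B ] (IsBasis B × I ⊆ B)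

  IsCircuit : Subset n → Set
  IsCircuit C = ¬ Independent C × (∀ D → D ⊂ C → Independent D)

  MeetsAllBases : Subset n → Set
  MeetsAllBases D = ∀ B → IsBasis B → Nonempty (D ∩ B)

  IsCocircuit : Subset n → Set
  IsCocircuit D = MeetsAllBases D × (∀ E → E ⊂ D → ¬ MeetsAllBases E)

  HasRank : ℕ → Set
  HasRank r = ∀ B → IsBasis B → ∣ B ∣ ≡ r

record FMatroid (T : Tract) (n r : ℕ) : Set₁ where
  open Tract T
  field
    M        : Matroid n
    rank     : Matroid.HasRank M r
    Circ     : Vec F n → Set
    Cocirc   : Vec F n → Set
    Circ-scale   : ∀ (u : U) X → Circ X → Circ (scale (just u) X)
    Cocirc-scale : ∀ (u : U) X → Cocirc X → Cocirc (scale (just u) X)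
    Circ-supp    : ∀ X → Circ X → Matroid.IsCircuit M (supp X)
    Cocirc-supp  : ∀ X → Cocirc X → Matroid.IsCocircuit M (supp X)
    Circ-exists   : ∀ C → Matroid.IsCircuit M C → ∃[ X ] (Circ X × supp X ≡ C)
    Circ-unique   : ∀ X Y → Circ X → Circ Y → supp X ≡ supp Y →
                    ∃[ u ] Y ≡ scale (just u) X
    Cocirc-exists : ∀ D → Matroid.IsCocircuit M D → ∃[ X ] (Cocirc X × supp X ≡ D)
    Cocirc-unique : ∀ X Y → Cocirc X → Cocirc Y → supp X ≡ supp Y →
                    ∃[ u ] Y ≡ scale (just u) X
    orth : ∀ X Y → Circ X → Cocirc Y → Orthogonal X Y

  IsCovector : Vec F n → Set
  IsCovector X = ∀ Y → Circ Y → Orthogonal X Y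

module _ (T : Tract) where
  open Tract T

  Matrix : ℕ → ℕ → Set
  Matrix m n = Vec (Vec F n) m

  column : ∀ {m n} → Matrix m n → Fin n → Vec F m
  column A j = Data.Vec.map (λ row → lookup row j) A

  HasIndepColumns : ∀ {m n} → Matrix m n → ℕ → Set
  HasIndepColumns {m} {n} A k =
    Σ (Fin k → Fin n) λ σ →
      (∀ i j → σ i ≡ σ j → i ≡ j) × LinIndep (λ i → column A (σ i))

  IsColumnRank : ∀ {m n} → Matrix m n → ℕ → Set
  IsColumnRank A k = HasIndepColumns A k × (∀ l → HasIndepColumns A l → l ≤ k)

  RowsAreCovectors : ∀ {m n r} → Matrix m n → FMatroid T n r → Set
  RowsAreCovectors {m} A Mf = ∀ (i : Fin m) → FMatroid.IsCovector Mf (lookup A i)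

  AdmitsMatroidOfRank : ∀ {m n} → Matrix m n → ℕ → Set₁
  AdmitsMatroidOfRank {n = n} A r = Σ (FMatroid T n r) λ Mf → RowsAreCovectors A Mf

  IsMatroidalRank : ∀ {m n} → Matrix m n → ℕ → Set₁
  IsMatroidalRank A r = AdmitsMatroidOfRank A r × (∀ s → AdmitsMatroidOfRank A s → r ≤ s)

module Submission where

-- If k > r, the set S of the k chosen columns is too large to lie in a basis of the underlying
-- matroid, so it contains a circuit C. An F-circuit X with support C is orthogonal to every row
-- of A, and since supp X ⊆ S its entries on S are the coefficients of a nontrivial null
-- combination of the chosen columns. Finding C is classical, but k ≤ r is decidable, so it is
-- enough to argue under double negation.

open import Defs
open import Data.Nat using (ℕ; _≤_; _<_; _≤?_; zero; suc; z≤n; s≤s)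
open import Data.Nat.Properties using (≤-refl; ≤-trans; ≤-pred; ≤-reflexive)
open import Data.Fin using (Fin; zero; suc)
open import Data.Fin.Properties using (any?; _≟_; suc-injective; 0≢1+n)
open import Data.Fin.Subset using (Subset; _∈_; _∉_; _⊆_; _⊂_; _-_; ∣_∣; Nonempty; ⁅_⁆)
open import Data.Fin.Subset.Properties
  using (_∈?_; nonempty?; ⊆-refl; p─q⊆p; x∈p∧x≢y⇒x∈p-y; x∈p⇒∣p-x∣<∣p∣; p⊆q⇒∣p∣≤∣q∣)
open import Data.Maybe using (Maybe; just; nothing; is-just)
open import Data.List using (List; []; _∷_; catMaybes; tabulate)
open import Data.List.Properties using (tabulate-cong)
open import Data.List.Relation.Binary.Permutation.Propositional
  using (_↭_; prep; swap; ↭-reflexive; module PermutationReasoning) renaming (refl to ↭-refl)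
open import Data.List.Relation.Binary.Permutation.Propositional.Properties using (catMaybes-↭)
open import Data.Vec using (Vec; lookup)
import Data.Vec as Vec
open import Data.Vec.Properties using (lookup-map; []=⇒lookup; lookup⇒[]=; lookup∘tabulate)
open import Data.Vec.Functional using (updateAt)
open import Data.Vec.Functional.Properties using (updateAt-updates; updateAt-minimal)
open import Data.Product using (∃-syntax; _×_; _,_; uncurry)
open import Data.Empty using (⊥-elim)
open import Effect.Monad using (RawMonad)
open import Level using (0ℓ)
open import Function using (_∘_; const)
open import Function.Definitions using (Injective)
open import Relation.Binary.PropositionalEquality using (_≡_; _≢_; refl; sym; trans; cong; subst)
open import Relation.Nullary using (¬_; yes; no; does; ¬?; _×-dec_)
open import Relation.Nullary.Decidable using (decidable-stable; ¬¬-excluded-middle)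
open import Relation.Nullary.Negation using (¬¬-Monad; ¬¬-map)
open import Relation.Unary using (Pred; Decidable)

open RawMonad (¬¬-Monad {a = 0ℓ}) using (pure; _>>=_)

private variable
  A : Set

∷-tabulate-↭-updateAt : ∀ {n} x (f : Fin n → A) j →
  x ∷ tabulate f ↭ f j ∷ tabulate (updateAt f j (const x))
∷-tabulate-↭-updateAt x f zero    = swap x (f zero) ↭-refl
∷-tabulate-↭-updateAt x f (suc j) = begin
  x ∷ f zero ∷ tabulate (f ∘ suc)                                ↭⟨ swap x (f zero) ↭-refl ⟩
  f zero ∷ x ∷ tabulate (f ∘ suc)                                ↭⟨ prep (f zero) (∷-tabulate-↭-updateAt x (f ∘ suc) j) ⟩
  f zero ∷ f (suc j) ∷ tabulate (updateAt (f ∘ suc) j (const x)) ↭⟨ swap (f zero) (f (suc j)) ↭-refl ⟩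
  f (suc j) ∷ f zero ∷ tabulate (updateAt (f ∘ suc) j (const x)) ∎
  where open PermutationReasoning

catMaybes-∷⁺ : ∀ m (xs ys : List (Maybe A)) →
  catMaybes xs ↭ catMaybes ys → catMaybes (m ∷ xs) ↭ catMaybes (m ∷ ys)
catMaybes-∷⁺ (just x) _ _ xs↭ys = prep x xs↭ys
catMaybes-∷⁺ nothing  _ _ xs↭ys = xs↭ys

catMaybes-tabulate-nothing : ∀ {n} (f : Fin n → Maybe A) → (∀ j → f j ≡ nothing) →
  catMaybes (tabulate f) ≡ []
catMaybes-tabulate-nothing {n = zero} f f≡nothing = refl
catMaybes-tabulate-nothing {n = suc n} f f≡nothing with f zero | f≡nothing zero
... | nothing | refl = catMaybes-tabulate-nothing (f ∘ suc) (f≡nothing ∘ suc)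

catMaybes-tabulate-↭-∘ : ∀ {k n} (f : Fin n → Maybe A) (σ : Fin k → Fin n) →
  Injective _≡_ _≡_ σ → (∀ j → (∀ l → σ l ≢ j) → f j ≡ nothing) →
  catMaybes (tabulate f) ↭ catMaybes (tabulate (f ∘ σ))
catMaybes-tabulate-↭-∘ {k = zero} f σ _ outside≡nothing =
  ↭-reflexive (catMaybes-tabulate-nothing f λ j → outside≡nothing j λ ())
catMaybes-tabulate-↭-∘ {A} {k = suc k} {n} f σ σ-inj outside≡nothing = begin
  catMaybes (tabulate f)                          ↭⟨ catMaybes-↭ (∷-tabulate-↭-updateAt nothing f (σ zero)) ⟩
  catMaybes (f (σ zero) ∷ tabulate g)             ↭⟨ catMaybes-∷⁺ (f (σ zero)) (tabulate g) (tabulate (g ∘ σ ∘ suc))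
                                                        (catMaybes-tabulate-↭-∘ g (σ ∘ suc)
                                                        (suc-injective ∘ σ-inj) g-outside≡nothing) ⟩
  catMaybes (f (σ zero) ∷ tabulate (g ∘ σ ∘ suc)) ≡⟨ cong (catMaybes ∘ (f (σ zero) ∷_)) (tabulate-cong g∘σ∘suc≗f∘σ∘suc) ⟩
  catMaybes (tabulate (f ∘ σ))                    ∎
  where
  open PermutationReasoning
  g : Fin n → Maybe A
  g = updateAt f (σ zero) (const nothing)
  g∘σ∘suc≗f∘σ∘suc : ∀ l → g (σ (suc l)) ≡ f (σ (suc l))
  g∘σ∘suc≗f∘σ∘suc l = updateAt-minimal (σ (suc l)) (σ zero) f (0≢1+n ∘ sym ∘ σ-inj)
  g-outside≡nothing : ∀ j → (∀ l → σ (suc l) ≢ j) → g j ≡ nothing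
  g-outside≡nothing j j∉σ∘suc with j ≟ σ zero
  ... | yes refl = updateAt-updates (σ zero) f
  ... | no j≢σ0  = trans (updateAt-minimal j (σ zero) f j≢σ0)
                     (outside≡nothing j λ { zero → j≢σ0 ∘ sym ; (suc l) → j∉σ∘suc l })

image : ∀ {k n} → (Fin k → Fin n) → Subset n
image σ = Vec.tabulate λ j → does (any? λ l → σ l ≟ j)

∈-image : ∀ {k n} (σ : Fin k → Fin n) l → σ l ∈ image σ
∈-image σ l with any? (λ l′ → σ l′ ≟ σ l) in eq
... | yes _ = lookup⇒[]= (σ l) (image σ) (trans (lookup∘tabulate _ (σ l)) (cong does eq))
... | no ∄ = ⊥-elim (∄ (l , refl))

∈-image⁻ : ∀ {k n} (σ : Fin k → Fin n) {j} → j ∈ image σ → ∃[ l ] σ l ≡ j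
∈-image⁻ σ {j} j∈image with any? (λ l → σ l ≟ j) in eq
... | yes σl≡j = σl≡j
... | no _ with () ← trans (sym (trans (lookup∘tabulate _ j) (cong does eq))) ([]=⇒lookup j∈image)

injective⇒≤∣p∣ : ∀ {k n} (σ : Fin k → Fin n) → Injective _≡_ _≡_ σ →
  (p : Subset n) → (∀ l → σ l ∈ p) → k ≤ ∣ p ∣
injective⇒≤∣p∣ {zero}  σ σ-inj p σ∈p = z≤n
injective⇒≤∣p∣ {suc k} σ σ-inj p σ∈p = ≤-trans
  (s≤s (injective⇒≤∣p∣ (σ ∘ suc) (suc-injective ∘ σ-inj) (p - σ zero)
          λ l → x∈p∧x≢y⇒x∈p-y (σ∈p (suc l)) (0≢1+n ∘ sym ∘ σ-inj)))
  (x∈p⇒∣p-x∣<∣p∣ (σ∈p zero))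

¬¬-decidable : ∀ {n} (P : Pred (Fin n) 0ℓ) → ¬ ¬ Decidable P
¬¬-decidable {zero}  P = pure λ ()
¬¬-decidable {suc n} P = do
  P0? ← ¬¬-excluded-middle
  P∘suc? ← ¬¬-decidable (P ∘ suc)
  pure λ { zero → P0? ; (suc j) → P∘suc? j }

module MatroidProperties {n} (M : Matroid n) where
  open Matroid M

  independent-⊆ : ∀ {I J} → I ⊆ J → Independent J → Independent I
  independent-⊆ I⊆J (B , B-basis , J⊆B) = B , B-basis , J⊆B ∘ I⊆J

  circuit-nonempty : ∀ {C} → IsCircuit C → Nonempty C
  circuit-nonempty {C} (dependent , _) with nonempty? C
  ... | yes nonempty = nonempty
  ... | no empty with B , B-basis ← basis-exists =
    ⊥-elim (dependent (B , B-basis , λ {x} x∈C → ⊥-elim (empty (x , x∈C))))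

  -- Independence is not decidable, so the minimal dependent subset is only found up to double negation.
  dependent⇒¬¬circuit : ∀ D → ¬ Independent D → ¬ ¬ (∃[ C ] (IsCircuit C × C ⊆ D))
  dependent⇒¬¬circuit D = bounded (suc ∣ D ∣) D ≤-refl
    where
    bounded : ∀ s D → ∣ D ∣ < s → ¬ Independent D → ¬ ¬ (∃[ C ] (IsCircuit C × C ⊆ D))
    bounded (suc s) D ∣D∣<1+s dependent = ¬¬-decidable (λ x → Independent (D - x)) >>= shrink
      where
      shrink : Decidable (λ x → Independent (D - x)) → ¬ ¬ (∃[ C ] (IsCircuit C × C ⊆ D))
      shrink independent? with any? (λ x → x ∈? D ×-dec ¬? (independent? x))
      ... | yes (x , x∈D , D-x-dependent) =
        ¬¬-map (λ (C , C-circuit , C⊆D-x) → C , C-circuit , λ {y} y∈C → p─q⊆p D ⁅ x ⁆ (C⊆D-x y∈C))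
               (bounded s (D - x) (≤-trans (x∈p⇒∣p-x∣<∣p∣ x∈D) (≤-pred ∣D∣<1+s)) D-x-dependent)
      ... | no ¬shrinkable = λ no-circuit → no-circuit (D , (dependent , minimal) , ⊆-refl)
        where
        minimal : ∀ E → E ⊂ D → Independent E
        minimal E (E⊆D , x , x∈D , x∉E) with independent? x
        ... | yes D-x-independent = independent-⊆
              (λ y∈E → x∈p∧x≢y⇒x∈p-y (E⊆D y∈E) λ { refl → x∉E y∈E }) D-x-independent
        ... | no D-x-dependent = ⊥-elim (¬shrinkable (x , x∈D , D-x-dependent))

  independent⇒∣∣≤rank : ∀ {r I} → HasRank r → Independent I → ∣ I ∣ ≤ r
  independent⇒∣∣≤rank rank (B , B-basis , I⊆B) = ≤-trans (p⊆q⇒∣p∣≤∣q∣ I⊆B) (≤-reflexive (rank B B-basis))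

module TractProperties (T : Tract) where
  open Tract T

  *-comm : ∀ a b → a * b ≡ b * a
  *-comm (just x) (just y) = cong just (·-comm x y)
  *-comm (just x) nothing  = refl
  *-comm nothing  (just y) = refl
  *-comm nothing  nothing  = refl

  *-zeroʳ : ∀ a → a * nothing ≡ nothing
  *-zeroʳ (just x) = refl
  *-zeroʳ nothing  = refl

  ∈-supp⁻ : ∀ {n} (X : Vec F n) {j} → j ∈ supp X → lookup X j ≢ nothing
  ∈-supp⁻ X {j} j∈supp Xj≡nothing
    with () ← trans (sym ([]=⇒lookup j∈supp)) (trans (lookup-map j is-just X) (cong is-just Xj≡nothing))

  ∉-supp⁻ : ∀ {n} (X : Vec F n) {j} → j ∉ supp X → lookup X j ≡ nothing
  ∉-supp⁻ X {j} j∉supp with lookup X j in Xj≡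
  ... | nothing = refl
  ... | just _  = ⊥-elim (j∉supp (lookup⇒[]= j (supp X) (trans (lookup-map j is-just X) (cong is-just Xj≡))))

  orthogonal-to-rows⇒columns-dependent : ∀ {m n k} (A : Matrix T m n) (σ : Fin k → Fin n) →
    Injective _≡_ _≡_ σ → (X : Vec F n) → Nonempty (supp X) → supp X ⊆ image σ →
    (∀ i → Orthogonal (lookup A i) X) → LinDep (λ l → column T A (σ l))
  orthogonal-to-rows⇒columns-dependent {n = n} {k = k} A σ σ-inj X (j , j∈supp) supp⊆image orthogonal
    with l , refl ← ∈-image⁻ σ (supp⊆image j∈supp) = c , (l , ∈-supp⁻ X j∈supp) , row-null
    where
    c : Fin k → F
    c l = lookup X (σ l)
    row-null : ∀ i → NullSum (tabulate λ l → c l * lookup (column T A (σ l)) i)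
    row-null i = N-perm (begin
      catMaybes (tabulate f)       ↭⟨ catMaybes-tabulate-↭-∘ f σ σ-inj f-outside≡nothing ⟩
      catMaybes (tabulate (f ∘ σ)) ≡⟨ cong catMaybes (tabulate-cong f∘σ≗coefficient) ⟩
      catMaybes (tabulate λ l → c l * lookup (column T A (σ l)) i) ∎) (orthogonal i)
      where
      open PermutationReasoning
      f : Fin n → F
      f j = lookup (lookup A i) j * lookup X j
      f-outside≡nothing : ∀ j → (∀ l → σ l ≢ j) → f j ≡ nothing
      f-outside≡nothing j j∉σ = trans
        (cong (lookup (lookup A i) j *_) (∉-supp⁻ X λ j∈supp → uncurry j∉σ (∈-image⁻ σ (supp⊆image j∈supp))))
        (*-zeroʳ _)
      f∘σ≗coefficient : ∀ l → f (σ l) ≡ c l * lookup (column T A (σ l)) i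
      f∘σ≗coefficient l = trans (*-comm _ _) (cong (c l *_) (sym (lookup-map i (λ row → lookup row (σ l)) A)))

open TractProperties

proposition3p5 : (T : Tract) (m n : ℕ) (A : Matrix T m n) (k r : ℕ) →
    IsColumnRank T A k → IsMatroidalRank T A r → k ≤ r
proposition3p5 T m n A k r ((σ , σ-inj , columns-independent) , _) ((Mf , rows-covectors) , _) =
  decidable-stable (k ≤? r) (¬¬-map k≤r ¬¬image-independent)
  where
  open FMatroid Mf
  open Matroid M using (Independent)
  open MatroidProperties M
  k≤r : Independent (image σ) → k ≤ r
  k≤r image-independent = ≤-trans (injective⇒≤∣p∣ σ (σ-inj _ _) (image σ) (∈-image σ))
                                   (independent⇒∣∣≤rank rank image-independent)
  ¬¬image-independent : ¬ ¬ Independent (image σ)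
  ¬¬image-independent image-dependent = dependent⇒¬¬circuit (image σ) image-dependent
    λ (C , C-circuit , C⊆image) → let (X , X-circuit , suppX≡C) = Circ-exists C C-circuit in
      columns-independent (orthogonal-to-rows⇒columns-dependent T A σ (σ-inj _ _) X
        (subst Nonempty (sym suppX≡C) (circuit-nonempty C-circuit))
        (subst (_⊆ image σ) (sym suppX≡C) C⊆image)
        λ i → rows-covectors i X X-circuit)
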